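{- (ZFC) If $m$ and $n$ are positive integers with $m\leq n$, then the boolean algebra $\mathcal{B}_m$ is isomorphic to a subalgebra of $\mathcal{B}_n$.
   Context: For $k\ge1$, $I_{\omega^k}=\{P\subseteq\omega^k\mid \mathrm{o.t.}(P)<\omega^k\}$ where $\mathrm{o.t.}(P)$ is the order type of $P$ as a suborder of $(\omega^k,<)$, and $\mathcal{B}_k=(\mathcal{P}(\omega^k)/I_{\omega^k},\cap,\cup,\neg,\mathbf{0},\mathbf{1})$ is the quotient boolean algebra of $\mathcal{P}(\omega^k)$ modulo the ideal $I_{\omega^k}$. -}

module Defs where

open import Data.Nat using (ℕ; _<_; _≤_)
open import Data.Bool using (Bool; true; false; _∧_; _∨_; not; _xor_)
open import Data.Vec using (Vec; []; _∷_)
open import Data.Product using (Σ; ∃; _×_; _,_; proj₁)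
open import Data.Sum using (_⊎_)
open import Data.Empty using (⊥)
open import Relation.Binary.PropositionalEquality using (_≡_)

-- The ordinal ω^k is represented by Vec ℕ k (Cantor normal form
-- coefficients ω^(k-1)·a₀ + … + a_(k-1)), ordered lexicographically with
-- the first coordinate most significant.
Pt : ℕ → Set
Pt k = Vec ℕ k

infix 4 _<ᴸ_
_<ᴸ_ : ∀ {k} → Pt k → Pt k → Set
[] <ᴸ [] = ⊥
(x ∷ xs) <ᴸ (y ∷ ys) = x < y ⊎ (x ≡ y × xs <ᴸ ys)

Subset : ℕ → Set
Subset k = Pt k → Bool

Elem : ∀ {k} → Subset k → Set
Elem {k} P = Σ (Pt k) λ x → P x ≡ true

Seg : ∀ {k} → Pt k → Set
Seg {k} a = Σ (Pt k) λ y → y <ᴸ a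

-- An order isomorphism between the suborder P and the segment below a
-- (strictly increasing surjection between linear orders).
record OrderIso {k : ℕ} (P : Subset k) (a : Pt k) : Set where
  field
    f       : Elem P → Seg a
    mono    : ∀ (x y : Elem P) → proj₁ x <ᴸ proj₁ y → proj₁ (f x) <ᴸ proj₁ (f y)
    onto    : ∀ (y : Seg a) → Σ (Elem P) λ x → proj₁ (f x) ≡ proj₁ y

-- o.t.(P) < ω^k : the order type of P is isomorphic to a proper initial
-- segment of ω^k (the definition of < between ordinals / well-orders).
OtLess : ∀ (k : ℕ) → Subset k → Set
OtLess k P = Σ (Pt k) λ a → OrderIso P a

InIdeal : ∀ (k : ℕ) → Subset k → Set
InIdeal k P = OtLess k P

_∩ˢ_ : ∀ {k} → Subset k → Subset k → Subset k
(P ∩ˢ Q) x = P x ∧ Q x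

_∪ˢ_ : ∀ {k} → Subset k → Subset k → Subset k
(P ∪ˢ Q) x = P x ∨ Q x

¬ˢ_ : ∀ {k} → Subset k → Subset k
(¬ˢ P) x = not (P x)

0ˢ : ∀ {k} → Subset k
0ˢ x = false

1ˢ : ∀ {k} → Subset k
1ˢ x = true

-- Equality in the quotient B_k = P(ω^k)/I_{ω^k}: symmetric difference
-- lies in the ideal.
EqB : ∀ (k : ℕ) → Subset k → Subset k → Set
EqB k P Q = InIdeal k (λ x → P x xor Q x)

-- B_m is isomorphic to a subalgebra of B_n: an injective boolean algebra
-- homomorphism B_m → B_n (given on representatives, respecting the
-- quotient).
record Embedding (m n : ℕ) : Set where
  field
    h        : Subset m → Subset n
    wd       : ∀ P Q → EqB m P Q → EqB n (h P) (h Q)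
    pres-∩   : ∀ P Q → EqB n (h (P ∩ˢ Q)) (h P ∩ˢ h Q)
    pres-∪   : ∀ P Q → EqB n (h (P ∪ˢ Q)) (h P ∪ˢ h Q)
    pres-¬   : ∀ P → EqB n (h (¬ˢ P)) (¬ˢ h P)
    pres-0   : EqB n (h 0ˢ) 0ˢ
    pres-1   : EqB n (h 1ˢ) 1ˢ
    injective : ∀ P Q → EqB n (h P) (h Q) → EqB m P Q

module Submission where

open import Defs
open import Data.Nat using (ℕ; _≤_)
open import Axiom.ExcludedMiddle using (ExcludedMiddle)
open import Level using (0ℓ)

open import Data.Nat using (zero; suc; _+_; _<_; s≤s; z≤n)
import Data.Nat.Properties as ℕ
open import Data.Nat.Induction using () renaming (<-wellFounded to ℕ-<-wellFounded)
open import Data.Bool using (true; false; _xor_)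
import Data.Bool.Properties as Bool
open import Data.Vec using ([]; _∷_; _++_; take; drop; replicate; zipWith)
open import Data.Vec.Properties using (take++drop≡id)
import Data.Vec.Relation.Binary.Lex.Strict as Lex
open import Data.Product using (Σ; _×_; _,_; proj₁; proj₂)
open import Data.Sum using (_⊎_; inj₁; inj₂)
open import Data.Empty using (⊥; ⊥-elim)
open import Function using (_∘_)
open import Relation.Nullary using (¬_)
open import Relation.Binary.Definitions using (tri<; tri≈; tri>)
open import Relation.Binary.PropositionalEquality
open import Induction.WellFounded using (Acc; acc; WellFounded; module Subrelation)
open import Axiom.UniquenessOfIdentityProofs using (module Decidable⇒UIP)

-- Identify ω^(M+d) with ω^M × ω^d ordered lexicographically
-- (a point is a block s ∈ ω^M followed by a position z ∈ ω^d) and send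
-- P ⊆ ω^M to its cylinder P × ω^d.  Boolean operations are pointwise, hence
-- preserved on the nose; applied to symmetric differences, everything rests on
--   (A) o.t.(R) < ω^M  implies  o.t.(R × ω^d) < ω^(M+d)   (well-definedness),
--   (B) the converse, for M ≥ 1                            (injectivity).
-- (A) is explicit: R ≅ [0,a) gives R × ω^d ≅ [0, a ++ 0).  For (B), an
-- isomorphism G : R × ω^d ≅ [0,b) maps each fibre {s} × ω^d into one block
-- and distinct fibres into distinct blocks, because the well-order ω^d has no
-- strictly increasing map into a proper initial segment of itself
-- (no-squeeze); so s ↦ block of G(s,0) maps R onto the blocks below the
-- ceiling of b.  The file develops the lexicographic order, the block
-- decomposition and no-squeeze, facts on order isomorphisms, then (A), (B)
-- and the embedding.  The argument is constructive (excluded middle unused).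

<ᴸ-irrefl : ∀ {k} {x : Pt k} → ¬ x <ᴸ x
<ᴸ-irrefl {x = x ∷ xs} (inj₁ x<x) = ℕ.<-irrefl refl x<x
<ᴸ-irrefl {x = x ∷ xs} (inj₂ (_ , xs<xs)) = <ᴸ-irrefl xs<xs

<ᴸ-trans : ∀ {k} {x y z : Pt k} → x <ᴸ y → y <ᴸ z → x <ᴸ z
<ᴸ-trans {x = []} {[]} {[]} () _
<ᴸ-trans {x = _ ∷ _} {_ ∷ _} {_ ∷ _} (inj₁ p) (inj₁ q) = inj₁ (ℕ.<-trans p q)
<ᴸ-trans {x = _ ∷ _} {_ ∷ _} {_ ∷ _} (inj₁ p) (inj₂ (refl , _)) = inj₁ p
<ᴸ-trans {x = _ ∷ _} {_ ∷ _} {_ ∷ _} (inj₂ (refl , _)) (inj₁ q) = inj₁ q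
<ᴸ-trans {x = _ ∷ _} {_ ∷ _} {_ ∷ _} (inj₂ (refl , p)) (inj₂ (refl , q)) =
  inj₂ (refl , <ᴸ-trans p q)

data Comparison {k} (x y : Pt k) : Set where
  lt : x <ᴸ y → Comparison x y
  eq : x ≡ y → Comparison x y
  gt : y <ᴸ x → Comparison x y

<ᴸ-compare : ∀ {k} (x y : Pt k) → Comparison x y
<ᴸ-compare [] [] = eq refl
<ᴸ-compare (x ∷ xs) (y ∷ ys) with ℕ.<-cmp x y
... | tri< x<y _ _ = lt (inj₁ x<y)
... | tri> _ _ y<x = gt (inj₁ y<x)
... | tri≈ _ refl _ with <ᴸ-compare xs ys
...   | lt xs<ys = lt (inj₂ (refl , xs<ys))
...   | eq refl = eq refl
...   | gt ys<xs = gt (inj₂ (refl , ys<xs))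

infix 4 _≤ᴸ_
_≤ᴸ_ : ∀ {k} → Pt k → Pt k → Set
x ≤ᴸ y = x <ᴸ y ⊎ x ≡ y

≤<-trans : ∀ {k} {x y z : Pt k} → x ≤ᴸ y → y <ᴸ z → x <ᴸ z
≤<-trans (inj₁ x<y) y<z = <ᴸ-trans x<y y<z
≤<-trans (inj₂ refl) y<z = y<z

-- ω^k is well-ordered: our order is the library's strict lexicographic
-- order on vectors over (ℕ, <), whose well-foundedness we reuse.

toLex : ∀ {k} {x y : Pt k} → x <ᴸ y → Lex.Lex-< _≡_ _<_ x y
toLex {x = []} {[]} ()
toLex {x = _ ∷ _} {_ ∷ _} (inj₁ x<y) = Lex.this x<y refl
toLex {x = _ ∷ _} {_ ∷ _} (inj₂ (refl , xs<ys)) = Lex.next refl (toLex xs<ys)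

<ᴸ-wellFounded : ∀ {k} → WellFounded (_<ᴸ_ {k})
<ᴸ-wellFounded =
  Subrelation.wellFounded toLex
    (Lex.<-wellFounded trans (proj₁ ℕ.<-resp₂-≡) ℕ-<-wellFounded)

StrictMono : ∀ {j k} → (Pt j → Pt k) → Set
StrictMono φ = ∀ {x y} → x <ᴸ y → φ x <ᴸ φ y

-- In a well-order a strictly increasing self-map never moves a point down;
-- so ω^d has no strictly increasing map into a proper initial segment.
no-bounded-strictMono : ∀ {d} {φ : Pt d → Pt d} (v : Pt d) →
                        StrictMono φ → ¬ (∀ z → φ z <ᴸ v)
no-bounded-strictMono {φ = φ} v mono bounded = descent v (<ᴸ-wellFounded v) (bounded v)
  where
  descent : ∀ x → Acc _<ᴸ_ x → ¬ φ x <ᴸ x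
  descent x (acc rec) φx<x = descent (φ x) (rec φx<x) (mono φx<x)

0ᴾ : ∀ d → Pt d
0ᴾ d = replicate d 0

0ᴾ-least : ∀ {d} (u : Pt d) → 0ᴾ d ≤ᴸ u
0ᴾ-least [] = inj₂ refl
0ᴾ-least (suc x ∷ u) = inj₁ (inj₁ ℕ.0<1+n)
0ᴾ-least (zero ∷ u) with 0ᴾ-least u
... | inj₁ 0<u = inj₁ (inj₂ (refl , 0<u))
... | inj₂ 0≡u = inj₂ (cong (0 ∷_) 0≡u)

≮0ᴾ : ∀ {d} (u : Pt d) → ¬ u <ᴸ 0ᴾ d
≮0ᴾ u u<0 = <ᴸ-irrefl (≤<-trans (0ᴾ-least u) u<0)

-- Coordinatewise translation u ⊕ w: an inflationary, strictly increasing
-- (in w) map, used to produce copies of ω^d above a given point.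

_⊕_ : ∀ {d} → Pt d → Pt d → Pt d
_⊕_ = zipWith _+_

⊕-inflationary : ∀ {d} (u w : Pt d) → u ≤ᴸ u ⊕ w
⊕-inflationary [] [] = inj₂ refl
⊕-inflationary (x ∷ u) (y ∷ w) with ℕ.m≤n⇒m<n∨m≡n (ℕ.m≤m+n x y) | ⊕-inflationary u w
... | inj₁ x<x+y | _ = inj₁ (inj₁ x<x+y)
... | inj₂ x≡x+y | inj₁ u<u⊕w = inj₁ (inj₂ (x≡x+y , u<u⊕w))
... | inj₂ x≡x+y | inj₂ u≡u⊕w = inj₂ (cong₂ _∷_ x≡x+y u≡u⊕w)

⊕-monoʳ : ∀ {d} (u : Pt d) → StrictMono (u ⊕_)
⊕-monoʳ [] {[]} {[]} ()
⊕-monoʳ (x ∷ u) {_ ∷ _} {_ ∷ _} (inj₁ y<y') = inj₁ (ℕ.+-monoʳ-< x y<y')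
⊕-monoʳ (x ∷ u) {_ ∷ _} {_ ∷ _} (inj₂ (refl , w<w')) = inj₂ (refl , ⊕-monoʳ u w<w')

-- Block decomposition: ω^(M+d) is ω^M × ω^d ordered lexicographically,
-- a point x being the block take M x followed by the position drop M x.

take-++ : ∀ {m d} (s : Pt m) (z : Pt d) → take m (s ++ z) ≡ s
take-++ [] z = refl
take-++ (x ∷ s) z = cong (x ∷_) (take-++ s z)

drop-++ : ∀ {m d} (s : Pt m) (z : Pt d) → drop m (s ++ z) ≡ z
drop-++ [] z = refl
drop-++ (x ∷ s) z = drop-++ s z

++-<ˡ : ∀ {m d} {s t : Pt m} {z w : Pt d} → s <ᴸ t → s ++ z <ᴸ t ++ w
++-<ˡ {s = []} {[]} ()
++-<ˡ {s = _ ∷ _} {_ ∷ _} (inj₁ x<y) = inj₁ x<y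
++-<ˡ {s = _ ∷ _} {_ ∷ _} (inj₂ (refl , s<t)) = inj₂ (refl , ++-<ˡ s<t)

++-<ʳ : ∀ {m d} (s : Pt m) {z w : Pt d} → z <ᴸ w → s ++ z <ᴸ s ++ w
++-<ʳ [] z<w = z<w
++-<ʳ (x ∷ s) z<w = inj₂ (refl , ++-<ʳ s z<w)

++-≤ʳ : ∀ {m d} (s : Pt m) {z w : Pt d} → z ≤ᴸ w → s ++ z ≤ᴸ s ++ w
++-≤ʳ s (inj₁ z<w) = inj₁ (++-<ʳ s z<w)
++-≤ʳ s (inj₂ refl) = inj₂ refl

++-<-inv : ∀ {m d} {s t : Pt m} {z w : Pt d} → s ++ z <ᴸ t ++ w →
           s <ᴸ t ⊎ (s ≡ t × z <ᴸ w)
++-<-inv {s = []} {[]} z<w = inj₂ (refl , z<w)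
++-<-inv {s = _ ∷ _} {_ ∷ _} (inj₁ x<y) = inj₁ (inj₁ x<y)
++-<-inv {s = _ ∷ _} {_ ∷ _} (inj₂ (refl , h)) with ++-<-inv h
... | inj₁ s<t = inj₁ (inj₂ (refl , s<t))
... | inj₂ (refl , z<w) = inj₂ (refl , z<w)

<ᴸ-blocks : ∀ M {d} {x y : Pt (M + d)} → x <ᴸ y →
            take M x <ᴸ take M y ⊎ (take M x ≡ take M y × drop M x <ᴸ drop M y)
<ᴸ-blocks M {x = x} {y} x<y =
  ++-<-inv (subst₂ _<ᴸ_ (sym (take++drop≡id M x)) (sym (take++drop≡id M y)) x<y)

take-mono-≤ : ∀ M {d} {x y : Pt (M + d)} → x ≤ᴸ y → take M x ≤ᴸ take M y
take-mono-≤ M (inj₂ refl) = inj₂ refl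
take-mono-≤ M (inj₁ x<y) with <ᴸ-blocks M x<y
... | inj₁ lower = inj₁ lower
... | inj₂ (same , _) = inj₂ same

same-block : ∀ M {d} {l x h : Pt (M + d)} → take M l ≡ take M h →
             l ≤ᴸ x → x <ᴸ h → take M x ≡ take M h × drop M x <ᴸ drop M h
same-block M l≈h l≤x x<h with <ᴸ-blocks M x<h
... | inj₂ inside = inside
... | inj₁ below =
  ⊥-elim (<ᴸ-irrefl (≤<-trans (take-mono-≤ M l≤x) (subst (_ <ᴸ_) (sym l≈h) below)))

-- No-squeeze: a strictly increasing copy of ω^d cannot fit between two
-- points of one block, since its positions would embed ω^d strictly below
-- the position of the upper point.
no-squeeze : ∀ M {d} {l h : Pt (M + d)} (ψ : Pt d → Pt (M + d)) → StrictMono ψ →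
             take M l ≡ take M h → (∀ z → l ≤ᴸ ψ z) → (∀ z → ψ z <ᴸ h) → ⊥
no-squeeze M {h = h} ψ ψ-mono l≈h lo hi =
  no-bounded-strictMono (drop M h) position-mono (proj₂ ∘ inside)
  where
  inside : ∀ z → take M (ψ z) ≡ take M h × drop M (ψ z) <ᴸ drop M h
  inside z = same-block M l≈h (lo z) (hi z)

  position-mono : StrictMono (drop M ∘ ψ)
  position-mono {z} {z'} z<z' with <ᴸ-blocks M (ψ-mono z<z')
  ... | inj₂ (_ , later) = later
  ... | inj₁ lower =
    ⊥-elim (<ᴸ-irrefl (subst₂ _<ᴸ_ (proj₁ (inside z)) (proj₁ (inside z')) lower))

succᴾ : ∀ {m} → Pt (suc m) → Pt (suc m)
succᴾ (x ∷ []) = suc x ∷ []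
succᴾ (x ∷ y ∷ ys) = x ∷ succᴾ (y ∷ ys)

<-succᴾ : ∀ {m} (c : Pt (suc m)) → c <ᴸ succᴾ c
<-succᴾ (x ∷ []) = inj₁ (ℕ.n<1+n x)
<-succᴾ (x ∷ y ∷ ys) = inj₂ (refl , <-succᴾ (y ∷ ys))

<succᴾ⇒≤ : ∀ {m} {y : Pt (suc m)} (c : Pt (suc m)) → y <ᴸ succᴾ c → y ≤ᴸ c
<succᴾ⇒≤ {y = y ∷ []} (x ∷ []) (inj₁ y<1+x) with ℕ.m<1+n⇒m<n∨m≡n y<1+x
... | inj₁ y<x = inj₁ (inj₁ y<x)
... | inj₂ refl = inj₂ refl
<succᴾ⇒≤ {y = _ ∷ _} (x ∷ y ∷ ys) (inj₁ lower) = inj₁ (inj₁ lower)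
<succᴾ⇒≤ {y = _ ∷ _} (x ∷ y ∷ ys) (inj₂ (refl , below)) with <succᴾ⇒≤ (y ∷ ys) below
... | inj₁ lower = inj₁ (inj₂ (refl , lower))
... | inj₂ refl = inj₂ refl

-- The block ceiling of c ++ v ∈ ω^(m+1+d): a block a such that the blocks
-- below a are exactly those meeting the segment below c ++ v.  It is c if
-- v = 0 and the successor of c otherwise (this needs a block of length ≥ 1).
ceiling : ∀ m {d} (c : Pt (suc m)) (v : Pt d) → Σ (Pt (suc m)) λ a →
          (∀ {s z} → s ++ z <ᴸ c ++ v → s <ᴸ a) × (∀ {y} → y <ᴸ a → y ++ 0ᴾ d <ᴸ c ++ v)
ceiling m {d} c v with 0ᴾ-least v
... | inj₂ refl = c , below-c , ++-<ˡ
  where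
  below-c : ∀ {s z} → s ++ z <ᴸ c ++ 0ᴾ d → s <ᴸ c
  below-c s++z<c++0 with ++-<-inv s++z<c++0
  ... | inj₁ s<c = s<c
  ... | inj₂ (_ , z<0) = ⊥-elim (≮0ᴾ _ z<0)
... | inj₁ 0<v = succᴾ c , below-succ , at-most-c
  where
  below-succ : ∀ {s z} → s ++ z <ᴸ c ++ v → s <ᴸ succᴾ c
  below-succ s++z<c++v with ++-<-inv s++z<c++v
  ... | inj₁ s<c = <ᴸ-trans s<c (<-succᴾ c)
  ... | inj₂ (refl , _) = <-succᴾ c

  at-most-c : ∀ {y} → y <ᴸ succᴾ c → y ++ 0ᴾ d <ᴸ c ++ v
  at-most-c y<succ with <succᴾ⇒≤ c y<succ
  ... | inj₁ y<c = ++-<ˡ y<c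
  ... | inj₂ refl = ++-<ʳ c 0<v

module OrderIsoProperties {k} {P : Subset k} {a : Pt k} (G : OrderIso P a) where
  open OrderIso G public using (f; mono)
  open OrderIso G using (onto)

  ⟪_⟫ : Elem P → Pt k
  ⟪ e ⟫ = proj₁ (f e)

  f-cong : ∀ (e e' : Elem P) → proj₁ e ≡ proj₁ e' → ⟪ e ⟫ ≡ ⟪ e' ⟫
  f-cong (x , p) (.x , q) refl =
    cong (λ r → ⟪ x , r ⟫) (Decidable⇒UIP.≡-irrelevant Bool._≟_ p q)

  f-mono-≤ : ∀ e e' → proj₁ e ≤ᴸ proj₁ e' → ⟪ e ⟫ ≤ᴸ ⟪ e' ⟫
  f-mono-≤ e e' (inj₁ e<e') = inj₁ (mono e e' e<e')
  f-mono-≤ e e' (inj₂ e≡e') = inj₂ (f-cong e e' e≡e')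

  f-reflects-< : ∀ e e' → ⟪ e ⟫ <ᴸ ⟪ e' ⟫ → proj₁ e <ᴸ proj₁ e'
  f-reflects-< e e' fe<fe' with <ᴸ-compare (proj₁ e) (proj₁ e')
  ... | lt e<e' = e<e'
  ... | eq e≡e' = ⊥-elim (<ᴸ-irrefl (subst (⟪ e ⟫ <ᴸ_) (sym (f-cong e e' e≡e')) fe<fe'))
  ... | gt e'<e = ⊥-elim (<ᴸ-irrefl (<ᴸ-trans fe<fe' (mono e' e e'<e)))

  f-reflects-≤ : ∀ e e' → ⟪ e ⟫ ≤ᴸ ⟪ e' ⟫ → proj₁ e ≤ᴸ proj₁ e'
  f-reflects-≤ e e' (inj₁ fe<fe') = inj₁ (f-reflects-< e e' fe<fe')
  f-reflects-≤ e e' (inj₂ fe≡fe') with <ᴸ-compare (proj₁ e) (proj₁ e')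
  ... | lt e<e' = inj₁ e<e'
  ... | eq e≡e' = inj₂ e≡e'
  ... | gt e'<e = ⊥-elim (<ᴸ-irrefl (subst (_<ᴸ ⟪ e ⟫) (sym fe≡fe') (mono e' e e'<e)))

  preimage : ∀ y → y <ᴸ a → Elem P
  preimage y y<a = proj₁ (onto (y , y<a))

  f-preimage : ∀ y (y<a : y <ᴸ a) → ⟪ preimage y y<a ⟫ ≡ y
  f-preimage y y<a = proj₂ (onto (y , y<a))

cylinder : ∀ M d → Subset M → Subset (M + d)
cylinder M d R x = R (take M x)

module Cylinder (M d : ℕ) (R : Subset M) where
  _⊗_ : Elem R → Pt d → Elem (cylinder M d R)
  s ⊗ z = proj₁ s ++ z , subst (λ t → R t ≡ true) (sym (take-++ (proj₁ s) z)) (proj₂ s)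

  base : Elem (cylinder M d R) → Elem R
  base x = take M (proj₁ x) , proj₂ x

-- (A) If R ≅ [0,a) then R × ω^d ≅ [0, a ++ 0), via (s , z) ↦ (G s , z).
cylinder-small : ∀ M d {R : Subset M} → OtLess M R → OtLess (M + d) (cylinder M d R)
cylinder-small M d {R} (a , G) = a ++ 0ᴾ d , record { f = F ; mono = F-mono ; onto = F-onto }
  where
  open Cylinder M d R
  open OrderIsoProperties G

  F : Elem (cylinder M d R) → Seg (a ++ 0ᴾ d)
  F x = ⟪ base x ⟫ ++ drop M (proj₁ x) , ++-<ˡ (proj₂ (f (base x)))

  F-mono : ∀ x y → proj₁ x <ᴸ proj₁ y → proj₁ (F x) <ᴸ proj₁ (F y)
  F-mono x y x<y with <ᴸ-blocks M x<y
  ... | inj₁ lower = ++-<ˡ (mono (base x) (base y) lower)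
  ... | inj₂ (same , later) rewrite f-cong (base x) (base y) same = ++-<ʳ _ later

  F-onto : ∀ (y : Seg (a ++ 0ᴾ d)) → Σ (Elem (cylinder M d R)) λ x → proj₁ (F x) ≡ proj₁ y
  F-onto (y , y<a0) with ++-<-inv (subst (_<ᴸ a ++ 0ᴾ d) (sym (take++drop≡id M y)) y<a0)
  ... | inj₂ (_ , below-0) = ⊥-elim (≮0ᴾ _ below-0)
  ... | inj₁ block<a = x , F-x
    where
    e = preimage (take M y) block<a
    x = e ⊗ drop M y

    F-x : ⟪ base x ⟫ ++ drop M (proj₁ e ++ drop M y) ≡ y
    F-x = begin
      ⟪ base x ⟫ ++ drop M (proj₁ e ++ drop M y)
        ≡⟨ cong₂ _++_ (f-cong (base x) e (take-++ _ _)) (drop-++ (proj₁ e) _) ⟩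
      ⟪ e ⟫ ++ drop M y
        ≡⟨ cong (_++ drop M y) (f-preimage _ block<a) ⟩
      take M y ++ drop M y
        ≡⟨ take++drop≡id M y ⟩
      y ∎
      where open ≡-Reasoning

-- (B) If G : R × ω^d ≅ [0,b) with M = m+1 ≥ 1, then R ≅ [0,a) for the block
-- ceiling a of b, via s ↦ block of G(s,0).
cylinder-small⁻¹ : ∀ m d {R : Subset (suc m)} →
                   OtLess (suc m + d) (cylinder (suc m) d R) → OtLess (suc m) R
cylinder-small⁻¹ m d {R} (b , G) = a , record { f = F ; mono = F-mono ; onto = F-onto }
  where
  M = suc m
  open Cylinder M d R
  open OrderIsoProperties G

  b-split : take M b ++ drop M b ≡ b
  b-split = take++drop≡id M b

  ceil = ceiling m (take M b) (drop M b)
  a = proj₁ ceil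

  a-above : ∀ {x} → x <ᴸ b → take M x <ᴸ a
  a-above {x} x<b =
    proj₁ (proj₂ ceil) (subst₂ _<ᴸ_ (sym (take++drop≡id M x)) (sym b-split) x<b)

  a-below : ∀ {y} → y <ᴸ a → y ++ 0ᴾ d <ᴸ b
  a-below y<a = subst (_ <ᴸ_) b-split (proj₂ (proj₂ ceil) y<a)

  image : Elem R → Pt d → Pt (M + d)
  image s z = ⟪ s ⊗ z ⟫

  image-from-0 : ∀ s z → image s (0ᴾ d) ≤ᴸ image s z
  image-from-0 s z = f-mono-≤ (s ⊗ 0ᴾ d) (s ⊗ z) (++-≤ʳ (proj₁ s) (0ᴾ-least z))

  -- G maps the whole fibre over s into the block p of G(s,0): otherwise the
  -- points p ++ (u ⊕ w) above G(s,0) = p ++ u would pull back to a copy of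
  -- ω^d squeezed inside the fibre, below (s,z).
  fibre-in-block : ∀ s z → take M (image s z) ≡ take M (image s (0ᴾ d))
  fibre-in-block s z with take-mono-≤ M (image-from-0 s z)
  ... | inj₂ same = sym same
  ... | inj₁ p<q = ⊥-elim (no-squeeze M ψ ψ-mono same-base lo hi)
    where
    p = take M (image s (0ᴾ d))
    u = drop M (image s (0ᴾ d))

    target : Pt d → Pt (M + d)
    target w = p ++ (u ⊕ w)

    target< : ∀ w → target w <ᴸ image s z
    target< w = subst (target w <ᴸ_) (take++drop≡id M (image s z)) (++-<ˡ p<q)

    X : Pt d → Elem (cylinder M d R)
    X w = preimage (target w) (<ᴸ-trans (target< w) (proj₂ (f (s ⊗ z))))

    G-X : ∀ w → ⟪ X w ⟫ ≡ target w
    G-X w = f-preimage _ _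

    ψ : Pt d → Pt (M + d)
    ψ w = proj₁ (X w)

    ψ-mono : StrictMono ψ
    ψ-mono {w} {w'} w<w' =
      f-reflects-< (X w) (X w') (subst₂ _<ᴸ_ (sym (G-X w)) (sym (G-X w')) (++-<ʳ p (⊕-monoʳ u w<w')))

    same-base : take M (proj₁ s ++ 0ᴾ d) ≡ take M (proj₁ s ++ z)
    same-base = trans (take-++ (proj₁ s) (0ᴾ d)) (sym (take-++ (proj₁ s) z))

    lo : ∀ w → proj₁ s ++ 0ᴾ d ≤ᴸ ψ w
    lo w = f-reflects-≤ (s ⊗ 0ᴾ d) (X w)
             (subst₂ _≤ᴸ_ (take++drop≡id M (image s (0ᴾ d))) (sym (G-X w))
                (++-≤ʳ p (⊕-inflationary u w)))

    hi : ∀ w → ψ w <ᴸ proj₁ s ++ z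
    hi w = f-reflects-< (X w) (s ⊗ z) (subst (_<ᴸ image s z) (sym (G-X w)) (target< w))

  F : Elem R → Seg a
  F s = take M (image s (0ᴾ d)) , a-above (proj₂ (f (s ⊗ 0ᴾ d)))

  -- Distinct fibres go to distinct blocks: if G(s,0) and G(t,0) shared a
  -- block for s < t, the fibre over s would be squeezed below G(t,0).
  F-mono : ∀ s t → proj₁ s <ᴸ proj₁ t → proj₁ (F s) <ᴸ proj₁ (F t)
  F-mono s t s<t with <ᴸ-blocks M (mono (s ⊗ 0ᴾ d) (t ⊗ 0ᴾ d) (++-<ˡ s<t))
  ... | inj₁ lower = lower
  ... | inj₂ (same , _) = ⊥-elim (no-squeeze M (image s) fibre-mono same (image-from-0 s) below-t)
    where
    fibre-mono : StrictMono (image s)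
    fibre-mono {z} {z'} z<z' = mono (s ⊗ z) (s ⊗ z') (++-<ʳ (proj₁ s) z<z')

    below-t : ∀ z → image s z <ᴸ image t (0ᴾ d)
    below-t z = mono (s ⊗ z) (t ⊗ 0ᴾ d) (++-<ˡ s<t)

  -- Every block y < a is hit: y ++ 0 = G(s,z) for some s, z, and the fibre
  -- over s lies in the block of G(s,0).
  F-onto : ∀ (y : Seg a) → Σ (Elem R) λ s → proj₁ (F s) ≡ proj₁ y
  F-onto (y , y<a) = s , F-s
    where
    x = preimage (y ++ 0ᴾ d) (a-below y<a)
    s = base x
    z = drop M (proj₁ x)

    image-sz : image s z ≡ y ++ 0ᴾ d
    image-sz = trans (f-cong (s ⊗ z) x (take++drop≡id M (proj₁ x))) (f-preimage _ _)

    F-s : take M (image s (0ᴾ d)) ≡ y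
    F-s = begin
      take M (image s (0ᴾ d)) ≡⟨ sym (fibre-in-block s z) ⟩
      take M (image s z)      ≡⟨ cong (take M) image-sz ⟩
      take M (y ++ 0ᴾ d)      ≡⟨ take-++ y _ ⟩
      y                       ∎
      where open ≡-Reasoning

-- Every set is equal to itself in B_k: P Δ P is empty, of order type 0.
EqB-refl : ∀ {k} (P : Subset k) → EqB k P P
EqB-refl {k} P = 0ᴾ k , record
  { f = λ { (x , x∈) → ⊥-elim (not-in x x∈) }
  ; mono = λ { (x , x∈) _ _ → ⊥-elim (not-in x x∈) }
  ; onto = λ { (y , y<0) → ⊥-elim (≮0ᴾ y y<0) }
  }
  where
  not-in : ∀ x → ¬ (P x xor P x ≡ true)
  not-in x x∈ with () ← trans (sym x∈) (Bool.xor-same (P x))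

-- Boolean operations commute
-- with taking cylinders definitionally; symmetric differences of cylinders
-- are cylinders over symmetric differences, so (A) and (B) apply.
cylinder-embedding : ∀ m d → Embedding (suc m) (suc m + d)
cylinder-embedding m d = record
  { h = cylinder M d
  ; wd = λ P Q → cylinder-small M d
  ; pres-∩ = λ P Q → EqB-refl (cylinder M d (P ∩ˢ Q))
  ; pres-∪ = λ P Q → EqB-refl (cylinder M d (P ∪ˢ Q))
  ; pres-¬ = λ P → EqB-refl (cylinder M d (¬ˢ P))
  ; pres-0 = EqB-refl 0ˢ
  ; pres-1 = EqB-refl 1ˢ
  ; injective = λ P Q → cylinder-small⁻¹ m d
  }
  where
  M = suc m

proposition6p2 : ExcludedMiddle 0ℓ → (m n : ℕ) → 1 ≤ m → m ≤ n → Embedding m n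
proposition6p2 _ (suc m) n (s≤s z≤n) m≤n with ℕ.m≤n⇒∃[o]m+o≡n m≤n
... | d , refl = cylinder-embedding m d
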